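{- For every integer $n\ge2$, the Laurent expansion at $q=0$ of the Bernoulli–Carlitz fraction $\beta_n$ satisfies $$\beta_n=\boldsymbol{\zeta}_q(1-n)\bigl(q-(n+1)q^2\bigr).$$ Explicitly, $\beta_n=\sum_{k\ge1}[k]^{n-1}q^k-(n+1)\sum_{k\ge1}[k]^{n-1}q^{2k}$.
   Context: For $n\ge1$, let $[n]=\frac{q^n-1}{q-1}=1+q+\dots+q^{n-1}$. For $s\in\mathbb{C}$, set $[n]^s=\exp(s\log[n])\in\mathbb{C}[[q]]$. Let $F_n(f)(q)=f(q^n)$. Define the operator $\boldsymbol{\zeta}_q(s)=\sum_{n\ge1}\frac{F_n}{[n]^s}$ on $q\,\mathbb{C}[[q]]$, where $\frac{F_n}{[n]^s}$ sends $f$ to $[n]^{ -s}f(q^n)$. The Bernoulli–Carlitz fractions $\beta_n\in\mathbb{Q}(q)$ are defined by $\beta_0=1$ and, for $n\ge1$, by $$q\sum_{i=0}^{n}\binom{n}{i}q^i\beta_i-\beta_n=\begin{cases}1&n=1,\\0&n>1.\end{cases}$$ This is the symbolic recurrence $q(q\beta+1)^n-\beta_n=\delta_{n,1}$, in which $\beta^i$ is replaced by $\beta_i$. For example, $\beta_1=-1/(1+q)$ and $\beta_2=q/((1+q)(1+q+q^2))$. -}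

module Defs where

open import Data.Nat as ℕ using (ℕ; zero; suc; _∸_; _≡ᵇ_; _<ᵇ_)
open import Data.Nat.Combinatorics using (_C_)
open import Data.Integer using (+_)
open import Data.Rational using (ℚ; 0ℚ; 1ℚ; _+_; _*_; _-_; _/_)
open import Data.Bool using (if_then_else_)
open import Relation.Binary.PropositionalEquality using (_≡_)
open import Data.Product using (_×_)

⟦_⟧ : ℕ → ℚ
⟦ n ⟧ = + n / 1

PS : Set
PS = ℕ → ℚ

_≐_ : PS → PS → Set
f ≐ g = ∀ m → f m ≡ g m
infix 4 _≐_

Σ< : ℕ → (ℕ → ℚ) → ℚ
Σ< zero    a = 0ℚ
Σ< (suc n) a = Σ< n a + a n

zeroPS : PS
zeroPS _ = 0ℚ

onePS : PS
onePS zero    = 1ℚ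
onePS (suc _) = 0ℚ

_⊕_ : PS → PS → PS
(f ⊕ g) m = f m + g m

_⊖_ : PS → PS → PS
(f ⊖ g) m = f m - g m

_·_ : ℚ → PS → PS
(c · f) m = c * f m

_⊛_ : PS → PS → PS
(f ⊛ g) m = Σ< (suc m) (λ i → f i * g (m ∸ i))

shift : ℕ → PS → PS
shift zero    f m       = f m
shift (suc k) f zero    = 0ℚ
shift (suc k) f (suc m) = shift k f m

qpow : ℕ → PS
qpow k = shift k onePS

ΣPS : ℕ → (ℕ → PS) → PS
ΣPS n F m = Σ< n (λ i → F i m)

_^PS_ : PS → ℕ → PS
f ^PS zero  = onePS
f ^PS suc e = f ⊛ (f ^PS e)

qint : ℕ → PS
qint k m = if m <ᵇ k then 1ℚ else 0ℚ

-- F_k f = f(q^k)   (meaningful for k ≥ 1)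
dil : ℕ → PS → PS
dil k f m = Σ< (suc m) (λ j → if j ℕ.* k ≡ᵇ m then f j else 0ℚ)

-- ζ_q(-e) applied to f ∈ q ℚ[[q]]:  Σ_{k ≥ 1} [k]^e · f(q^k).
-- For f with f 0 = 0, the summand with index k has no coefficients below q^k,
-- so the coefficient of q^m only receives contributions from k = 1..m.
ζneg : ℕ → PS → PS
ζneg e f m = Σ< m (λ j → (((qint (suc j)) ^PS e) ⊛ dil (suc j) f) m)

-- Σ_{k ≥ 1} [k]^e q^(c k)   (c ≥ 1; coefficient of q^m only needs k ≤ m)
lamSum : ℕ → ℕ → PS
lamSum e c m = Σ< m (λ j → ((qint (suc j) ^PS e) ⊛ qpow (c ℕ.* suc j)) m)

-- The defining recurrence of the Bernoulli–Carlitz fractions, read in ℚ[[q]]: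
-- β₀ = 1 and for n ≥ 1,  q Σ_{i=0}^n (n choose i) q^i β_i − β_n = δ_{n,1}.
IsBernoulliCarlitz : (ℕ → PS) → Set
IsBernoulliCarlitz b =
  (b 0 ≐ onePS) ×
  (∀ n → shift 1 (ΣPS (suc (suc n)) (λ i → ⟦ suc n C i ⟧ · shift i (b i))) ⊖ b (suc n)
          ≐ (if n ≡ᵇ 0 then onePS else zeroPS))

-- Write β_i = Σ_{k ≥ 0} ((1 - q) q^k [k]^i - i q^{2k} [k]^{i-1}), the k-th summand having valuation ≥ k.
-- By the binomial theorem and q [k] + 1 = [k+1], the umbral power q (q β + 1)^N of the k-th summands
-- is the (k+1)-th summand of β_N, while the 0-th summand of β_N is -δ_{N,1}; so these series satisfy
-- the Bernoulli–Carlitz recurrence, which determines its solution coefficient by coefficient.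
-- For N ≥ 2 and k ≥ 1 the geometric sum (1 - q) [k] = 1 - q^k turns the k-th summand of β_N into
-- [k]^{N-1} q^k - (N+1) [k]^{N-1} q^{2k}, the k-th term of ζ_q(1 - N)(q - (N+1) q^2) since F_k q^a = q^{ak}.

module Submission where

open import Defs

module BinomialCoefficients where

  open import Data.Nat
  open import Data.Nat.Combinatorics using (_C_; nCk+nC[k+1]≡[n+1]C[k+1]; nC1≡n)
  open import Data.Nat.Properties using (*-zeroʳ; *-comm)
  open import Data.Nat.Solver using (module +-*-Solver)
  open +-*-Solver using (solve; _:=_; _:+_; _:*_; con)
  open import Relation.Binary.PropositionalEquality
  open ≡-Reasoning

  [k+1]*[n+1]C[k+1]≡[n+1]*nCk : ∀ n k → suc k * (suc n C suc k) ≡ suc n * (n C k)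
  [k+1]*[n+1]C[k+1]≡[n+1]*nCk zero zero = refl
  [k+1]*[n+1]C[k+1]≡[n+1]*nCk zero (suc k) = *-zeroʳ (suc (suc k))
  [k+1]*[n+1]C[k+1]≡[n+1]*nCk (suc n) zero =
    trans (cong (1 *_) (nC1≡n (suc (suc n)))) (*-comm 1 (suc (suc n)))
  [k+1]*[n+1]C[k+1]≡[n+1]*nCk (suc n) (suc k) = begin
      suc (suc k) * (suc (suc n) C suc (suc k))
    ≡⟨ cong (suc (suc k) *_) (sym (nCk+nC[k+1]≡[n+1]C[k+1] (suc n) (suc k))) ⟩
      suc (suc k) * (suc n C suc k + suc n C suc (suc k))
    ≡⟨ solve 3 (λ K a b → (con 1 :+ K) :* (a :+ b) := (K :* a :+ a) :+ (con 1 :+ K) :* b)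
         refl (suc k) (suc n C suc k) (suc n C suc (suc k)) ⟩
      (suc k * (suc n C suc k) + suc n C suc k) + suc (suc k) * (suc n C suc (suc k))
    ≡⟨ cong₂ (λ u v → (u + suc n C suc k) + v)
         ([k+1]*[n+1]C[k+1]≡[n+1]*nCk n k) ([k+1]*[n+1]C[k+1]≡[n+1]*nCk n (suc k)) ⟩
      (suc n * (n C k) + suc n C suc k) + suc n * (n C suc k)
    ≡⟨ solve 4 (λ N a b c → (N :* a :+ c) :+ N :* b := N :* (a :+ b) :+ c)
         refl (suc n) (n C k) (n C suc k) (suc n C suc k) ⟩
      suc n * (n C k + n C suc k) + suc n C suc k
    ≡⟨ cong (λ u → suc n * u + suc n C suc k) (nCk+nC[k+1]≡[n+1]C[k+1] n k) ⟩
      suc n * (suc n C suc k) + suc n C suc k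
    ≡⟨ solve 2 (λ N a → N :* a :+ a := (con 1 :+ N) :* a) refl (suc n) (suc n C suc k) ⟩
      suc (suc n) * (suc n C suc k)
    ∎

module NatCast where

  open import Data.Nat using (suc)
  open import Data.Integer as ℤ using (+_)
  open import Data.Integer.Solver using (module +-*-Solver)
  open import Data.Nat.Coprimality using (1-coprimeTo; sym)
  open import Data.Rational using (1ℚ; _+_; mkℚ)
  open import Data.Rational.Properties using (normalize-coprime; toℚᵘ-injective; toℚᵘ-homo-+)
  import Data.Rational.Unnormalised as ℚᵘ
  import Data.Rational.Unnormalised.Properties as ℚᵘ
  open import Relation.Binary.PropositionalEquality using (_≡_; refl)
  open +-*-Solver using (solve; _:=_; _:+_; _:*_; con)

  ⟦⟧-suc : ∀ n → ⟦ suc n ⟧ ≡ 1ℚ + ⟦ n ⟧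
  ⟦⟧-suc n
    rewrite normalize-coprime (sym (1-coprimeTo (suc n))) | normalize-coprime (sym (1-coprimeTo n)) =
    toℚᵘ-injective (ℚᵘ.≃-trans (ℚᵘ.*≡* numerators)
                               (ℚᵘ.≃-sym (toℚᵘ-homo-+ 1ℚ (mkℚ (+ n) 0 (sym (1-coprimeTo n))))))
    where
    numerators : + suc n ℤ.* + 1 ≡ (+ 1 ℤ.* + 1 ℤ.+ + n ℤ.* + 1) ℤ.* + 1
    numerators = solve 1 (λ x → (con (+ 1) :+ x) :* con (+ 1)
                               := (con (+ 1) :* con (+ 1) :+ x :* con (+ 1)) :* con (+ 1)) refl (+ n)

module FiniteSums where

  open import Data.Nat as ℕ using (ℕ; zero; suc; _∸_; _<_)
  import Data.Nat.Properties as ℕ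
  open import Data.Rational using (ℚ; 0ℚ; _+_; _*_; _-_; -_)
  open import Data.Rational.Properties
  open import Algebra.Bundles using (CommutativeMonoid)
  open import Algebra.Properties.CommutativeSemigroup
    (CommutativeMonoid.commutativeSemigroup +-0-commutativeMonoid)
    renaming (interchange to +-interchange)
  open import Data.Sum using (inj₁; inj₂)
  open import Function using (_∘_)
  open import Relation.Binary.PropositionalEquality

  Σ<-cong : ∀ n {a b : ℕ → ℚ} → (∀ i → i < n → a i ≡ b i) → Σ< n a ≡ Σ< n b
  Σ<-cong zero    h = refl
  Σ<-cong (suc n) h = cong₂ _+_ (Σ<-cong n (λ i i<n → h i (ℕ.m<n⇒m<1+n i<n))) (h n ℕ.≤-refl)

  Σ<-cong-≗ : ∀ n {a b : ℕ → ℚ} → (∀ i → a i ≡ b i) → Σ< n a ≡ Σ< n b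
  Σ<-cong-≗ n h = Σ<-cong n (λ i _ → h i)

  Σ<-≡0 : ∀ n (a : ℕ → ℚ) → (∀ i → i < n → a i ≡ 0ℚ) → Σ< n a ≡ 0ℚ
  Σ<-≡0 zero    a h = refl
  Σ<-≡0 (suc n) a h = trans (cong₂ _+_ (Σ<-≡0 n a (λ i i<n → h i (ℕ.m<n⇒m<1+n i<n))) (h n ℕ.≤-refl))
                            (+-identityʳ 0ℚ)

  Σ<-single : ∀ n k (a : ℕ → ℚ) → k < n → (∀ i → i < n → i ≢ k → a i ≡ 0ℚ) → Σ< n a ≡ a k
  Σ<-single (suc n) k a k<1+n h with ℕ.m≤n⇒m<n∨m≡n (ℕ.≤-pred k<1+n)
  ... | inj₁ k<n = begin
    Σ< n a + a n  ≡⟨ cong (Σ< n a +_) (h n ℕ.≤-refl (λ n≡k → ℕ.<-irrefl (sym n≡k) k<n)) ⟩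
    Σ< n a + 0ℚ   ≡⟨ +-identityʳ (Σ< n a) ⟩
    Σ< n a        ≡⟨ Σ<-single n k a k<n (λ i i<n → h i (ℕ.m<n⇒m<1+n i<n)) ⟩
    a k           ∎
    where open ≡-Reasoning
  ... | inj₂ refl = trans (cong (_+ a k) (Σ<-≡0 k a λ i i<k → h i (ℕ.m<n⇒m<1+n i<k) (ℕ.<⇒≢ i<k)))
                          (+-identityˡ (a k))

  Σ<-distrib-+ : ∀ n (a b : ℕ → ℚ) → Σ< n (λ i → a i + b i) ≡ Σ< n a + Σ< n b
  Σ<-distrib-+ zero    a b = sym (+-identityʳ 0ℚ)
  Σ<-distrib-+ (suc n) a b = trans (cong (_+ (a n + b n)) (Σ<-distrib-+ n a b))
                                   (+-interchange (Σ< n a) (Σ< n b) (a n) (b n))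

  Σ<-neg : ∀ n (a : ℕ → ℚ) → Σ< n (λ i → - a i) ≡ - Σ< n a
  Σ<-neg zero    a = refl
  Σ<-neg (suc n) a = trans (cong (_+ (- a n)) (Σ<-neg n a)) (sym (neg-distrib-+ (Σ< n a) (a n)))

  Σ<-distrib-- : ∀ n (a b : ℕ → ℚ) → Σ< n (λ i → a i - b i) ≡ Σ< n a - Σ< n b
  Σ<-distrib-- n a b = trans (Σ<-distrib-+ n a (λ i → - b i)) (cong (Σ< n a +_) (Σ<-neg n b))

  *-distribˡ-Σ< : ∀ n c (a : ℕ → ℚ) → c * Σ< n a ≡ Σ< n (λ i → c * a i)
  *-distribˡ-Σ< zero    c a = *-zeroʳ c
  *-distribˡ-Σ< (suc n) c a =
    trans (*-distribˡ-+ c (Σ< n a) (a n)) (cong (_+ (c * a n)) (*-distribˡ-Σ< n c a))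

  *-distribʳ-Σ< : ∀ n c (a : ℕ → ℚ) → Σ< n a * c ≡ Σ< n (λ i → a i * c)
  *-distribʳ-Σ< n c a = trans (*-comm (Σ< n a) c)
    (trans (*-distribˡ-Σ< n c a) (Σ<-cong-≗ n (λ i → *-comm c (a i))))

  Σ<-suc : ∀ n (a : ℕ → ℚ) → Σ< (suc n) a ≡ a 0 + Σ< n (a ∘ suc)
  Σ<-suc zero    a = trans (+-identityˡ (a 0)) (sym (+-identityʳ (a 0)))
  Σ<-suc (suc n) a =
    trans (cong (_+ a (suc n)) (Σ<-suc n a)) (+-assoc (a 0) (Σ< n (a ∘ suc)) (a (suc n)))

  Σ<-reverse : ∀ n (a : ℕ → ℚ) → Σ< n (λ i → a (n ∸ suc i)) ≡ Σ< n a
  Σ<-reverse zero    a = refl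
  Σ<-reverse (suc n) a = trans (Σ<-suc n (λ i → a (n ∸ i)))
    (trans (cong (a n +_) (Σ<-reverse n a)) (+-comm (a n) (Σ< n a)))

  Σ<-swap : ∀ n p (a : ℕ → ℕ → ℚ) → Σ< n (λ i → Σ< p (a i)) ≡ Σ< p (λ k → Σ< n (λ i → a i k))
  Σ<-swap zero    p a = sym (Σ<-≡0 p _ (λ _ _ → refl))
  Σ<-swap (suc n) p a = trans (cong (_+ Σ< p (a n)) (Σ<-swap n p a))
    (sym (Σ<-distrib-+ p (λ k → Σ< n (λ i → a i k)) (a n)))

  Σ<-triangle : ∀ n (a : ℕ → ℕ → ℚ) →
    Σ< n (λ s → Σ< (suc s) (a s)) ≡ Σ< n (λ i → Σ< (n ∸ i) (λ j → a (i ℕ.+ j) i))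
  Σ<-triangle zero    a = refl
  Σ<-triangle (suc n) a = begin
      Σ< n (λ s → Σ< (suc s) (a s)) + Σ< (suc n) (a n)
    ≡⟨ cong₂ _+_ (Σ<-triangle n a) new-diagonal ⟩
      Σ< n row + Σ< (suc n) (λ i → b i (n ∸ i))
    ≡⟨ cong (_+ Σ< (suc n) (λ i → b i (n ∸ i))) (sym last-row-empty) ⟩
      Σ< (suc n) row + Σ< (suc n) (λ i → b i (n ∸ i))
    ≡⟨ sym (Σ<-distrib-+ (suc n) row (λ i → b i (n ∸ i))) ⟩
      Σ< (suc n) (λ i → Σ< (suc (n ∸ i)) (b i))
    ≡⟨ Σ<-cong (suc n) (λ i i<1+n → cong (λ m → Σ< m (b i)) (sym (ℕ.+-∸-assoc 1 (ℕ.≤-pred i<1+n)))) ⟩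
      Σ< (suc n) (λ i → Σ< (suc n ∸ i) (b i))
    ∎
    where
    open ≡-Reasoning
    b : ℕ → ℕ → ℚ
    b i j = a (i ℕ.+ j) i

    row : ℕ → ℚ
    row i = Σ< (n ∸ i) (b i)

    new-diagonal : Σ< (suc n) (a n) ≡ Σ< (suc n) (λ i → b i (n ∸ i))
    new-diagonal = Σ<-cong (suc n) (λ i i<1+n → cong (λ s → a s i) (sym (ℕ.m+[n∸m]≡n (ℕ.≤-pred i<1+n))))

    last-row-empty : Σ< (suc n) row ≡ Σ< n row
    last-row-empty = trans (cong (λ m → Σ< n row + Σ< m (b n)) (ℕ.n∸n≡0 n)) (+-identityʳ (Σ< n row))

module PowerSeries where

  open FiniteSums
  open import Algebra.Bundles using (CommutativeRing)
  open import Algebra.Structures using (IsCommutativeRing)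
  open import Data.Nat as ℕ using (ℕ; zero; suc; _∸_; _≤_; _<_; s≤s)
  import Data.Nat.Properties as ℕ
  open import Data.Product using (_,_)
  open import Data.Rational using (ℚ; 0ℚ; 1ℚ; _+_; _*_; -_)
  open import Data.Rational.Properties
  open import Level using (0ℓ)
  open import Relation.Binary.PropositionalEquality

  ≐-refl : ∀ {f} → f ≐ f
  ≐-refl m = refl

  ≐-sym : ∀ {f g} → f ≐ g → g ≐ f
  ≐-sym f≐g m = sym (f≐g m)

  ≐-trans : ∀ {f g h} → f ≐ g → g ≐ h → f ≐ h
  ≐-trans f≐g g≐h m = trans (f≐g m) (g≐h m)

  ⊛-cong : ∀ {f f′ g g′} → f ≐ f′ → g ≐ g′ → f ⊛ g ≐ f′ ⊛ g′
  ⊛-cong f≐f′ g≐g′ m = Σ<-cong-≗ (suc m) (λ i → cong₂ _*_ (f≐f′ i) (g≐g′ (m ∸ i)))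

  ⊛-comm : ∀ f g → f ⊛ g ≐ g ⊛ f
  ⊛-comm f g m = trans
    (Σ<-cong (suc m) (λ i i<1+m → trans (*-comm (f i) (g (m ∸ i)))
      (cong (λ j → g (m ∸ i) * f j) (sym (ℕ.m∸[m∸n]≡n (ℕ.≤-pred i<1+m))))))
    (Σ<-reverse (suc m) (λ i → g i * f (m ∸ i)))

  ⊛-assoc : ∀ f g h → (f ⊛ g) ⊛ h ≐ f ⊛ (g ⊛ h)
  ⊛-assoc f g h m = begin
      Σ< (suc m) (λ s → Σ< (suc s) (λ i → f i * g (s ∸ i)) * h (m ∸ s))
    ≡⟨ Σ<-cong-≗ (suc m) (λ s → *-distribʳ-Σ< (suc s) (h (m ∸ s)) (λ i → f i * g (s ∸ i))) ⟩
      Σ< (suc m) (λ s → Σ< (suc s) (λ i → f i * g (s ∸ i) * h (m ∸ s)))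
    ≡⟨ Σ<-triangle (suc m) (λ s i → f i * g (s ∸ i) * h (m ∸ s)) ⟩
      Σ< (suc m) (λ i → Σ< (suc m ∸ i) (term i))
    ≡⟨ Σ<-cong (suc m) (λ i i<1+m → inner i (ℕ.≤-pred i<1+m)) ⟩
      Σ< (suc m) (λ i → f i * Σ< (suc (m ∸ i)) (λ j → g j * h ((m ∸ i) ∸ j)))
    ∎
    where
    open ≡-Reasoning
    term : ℕ → ℕ → ℚ
    term i j = f i * g ((i ℕ.+ j) ∸ i) * h (m ∸ (i ℕ.+ j))

    inner : ∀ i → i ≤ m → Σ< (suc m ∸ i) (term i) ≡ f i * Σ< (suc (m ∸ i)) (λ j → g j * h ((m ∸ i) ∸ j))
    inner i i≤m = begin
        Σ< (suc m ∸ i) (term i)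
      ≡⟨ cong (λ l → Σ< l (term i)) (ℕ.+-∸-assoc 1 i≤m) ⟩
        Σ< (suc (m ∸ i)) (term i)
      ≡⟨ Σ<-cong-≗ (suc (m ∸ i)) (λ j → trans (*-assoc (f i) _ _)
           (cong₂ (λ u v → f i * (g u * h v)) (ℕ.m+n∸m≡n i j) (sym (ℕ.∸-+-assoc m i j)))) ⟩
        Σ< (suc (m ∸ i)) (λ j → f i * (g j * h ((m ∸ i) ∸ j)))
      ≡⟨ sym (*-distribˡ-Σ< (suc (m ∸ i)) (f i) (λ j → g j * h ((m ∸ i) ∸ j))) ⟩
        f i * Σ< (suc (m ∸ i)) (λ j → g j * h ((m ∸ i) ∸ j))
      ∎

  ⊛-distribˡ-⊕ : ∀ f g h → f ⊛ (g ⊕ h) ≐ (f ⊛ g) ⊕ (f ⊛ h)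
  ⊛-distribˡ-⊕ f g h m = trans (Σ<-cong-≗ (suc m) (λ i → *-distribˡ-+ (f i) (g (m ∸ i)) (h (m ∸ i))))
                               (Σ<-distrib-+ (suc m) _ _)

  ⊛-distribʳ-⊕ : ∀ f g h → (g ⊕ h) ⊛ f ≐ (g ⊛ f) ⊕ (h ⊛ f)
  ⊛-distribʳ-⊕ f g h = ≐-trans (⊛-comm (g ⊕ h) f) (≐-trans (⊛-distribˡ-⊕ f g h)
    (λ m → cong₂ _+_ (⊛-comm f g m) (⊛-comm f h m)))

  ⊛-identityˡ : ∀ f → onePS ⊛ f ≐ f
  ⊛-identityˡ f m = trans (Σ<-suc m (λ i → onePS i * f (m ∸ i)))
    (trans (cong₂ _+_ (*-identityˡ (f m)) (Σ<-≡0 m _ (λ i _ → *-zeroˡ (f (m ∸ suc i)))))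
           (+-identityʳ (f m)))

  ⊛-identityʳ : ∀ f → f ⊛ onePS ≐ f
  ⊛-identityʳ f = ≐-trans (⊛-comm f onePS) (⊛-identityˡ f)

  ⊝_ : PS → PS
  (⊝ f) m = - f m

  -- A record rather than _≐_ itself, so that f and g can be inferred from a proof of f ≈ₛ g.
  record _≈ₛ_ (f g : PS) : Set where
    constructor coeffwise
    field coeff : f ≐ g
  open _≈ₛ_ public
  infix 4 _≈ₛ_

  isCommutativeRing : IsCommutativeRing _≈ₛ_ _⊕_ _⊛_ ⊝_ zeroPS onePS
  isCommutativeRing = record
    { isRing = record
      { +-isAbelianGroup = record
        { isGroup = record
          { isMonoid = record
            { isSemigroup = record
              { isMagma = record
                { isEquivalence = record
                  { refl  = coeffwise ≐-refl
                  ; sym   = λ f≈g → coeffwise (≐-sym (coeff f≈g))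
                  ; trans = λ f≈g g≈h → coeffwise (≐-trans (coeff f≈g) (coeff g≈h)) }
                ; ∙-cong = λ f≈f′ g≈g′ → coeffwise (λ m → cong₂ _+_ (coeff f≈f′ m) (coeff g≈g′ m)) }
              ; assoc = λ f g h → coeffwise (λ m → +-assoc (f m) (g m) (h m)) }
            ; identity = (λ f → coeffwise (λ m → +-identityˡ (f m)))
                       , (λ f → coeffwise (λ m → +-identityʳ (f m))) }
          ; inverse = (λ f → coeffwise (λ m → +-inverseˡ (f m)))
                    , (λ f → coeffwise (λ m → +-inverseʳ (f m)))
          ; ⁻¹-cong = λ f≈g → coeffwise (λ m → cong -_ (coeff f≈g m)) }
        ; comm = λ f g → coeffwise (λ m → +-comm (f m) (g m)) }
      ; *-cong = λ f≈f′ g≈g′ → coeffwise (⊛-cong (coeff f≈f′) (coeff g≈g′))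
      ; *-assoc = λ f g h → coeffwise (⊛-assoc f g h)
      ; *-identity = (λ f → coeffwise (⊛-identityˡ f)) , (λ f → coeffwise (⊛-identityʳ f))
      ; distrib = (λ f g h → coeffwise (⊛-distribˡ-⊕ f g h))
                , (λ f g h → coeffwise (⊛-distribʳ-⊕ f g h)) }
    ; *-comm = λ f g → coeffwise (⊛-comm f g) }

  commutativeRing : CommutativeRing 0ℓ 0ℓ
  commutativeRing = record { isCommutativeRing = isCommutativeRing }

  shift-cong : ∀ k {f g} → f ≐ g → shift k f ≐ shift k g
  shift-cong zero    f≐g m       = f≐g m
  shift-cong (suc k) f≐g zero    = refl
  shift-cong (suc k) f≐g (suc m) = shift-cong k f≐g m

  shift-⊕ : ∀ k f g → shift k (f ⊕ g) ≐ shift k f ⊕ shift k g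
  shift-⊕ zero    f g m       = refl
  shift-⊕ (suc k) f g zero    = sym (+-identityʳ 0ℚ)
  shift-⊕ (suc k) f g (suc m) = shift-⊕ k f g m

  shift-zeroPS : ∀ k → shift k zeroPS ≐ zeroPS
  shift-zeroPS zero    m       = refl
  shift-zeroPS (suc k) zero    = refl
  shift-zeroPS (suc k) (suc m) = shift-zeroPS k m

  shift-ΣPS : ∀ k n F → shift k (ΣPS n F) ≐ ΣPS n (λ i → shift k (F i))
  shift-ΣPS k zero    F = shift-zeroPS k
  shift-ΣPS k (suc n) F m =
    trans (shift-⊕ k (ΣPS n F) (F n) m) (cong (_+ shift k (F n) m) (shift-ΣPS k n F m))

  shift-+ : ∀ a b f → shift (a ℕ.+ b) f ≐ shift a (shift b f)
  shift-+ zero    b f m       = refl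
  shift-+ (suc a) b f zero    = refl
  shift-+ (suc a) b f (suc m) = shift-+ a b f m

  shift-< : ∀ k f m → m < k → shift k f m ≡ 0ℚ
  shift-< (suc k) f zero    _         = refl
  shift-< (suc k) f (suc m) (s≤s m<k) = shift-< k f m m<k

  shift-local : ∀ k {f g} m → (∀ j → j ≤ m → f j ≡ g j) → shift k f m ≡ shift k g m
  shift-local zero    m       f≡g = f≡g m ℕ.≤-refl
  shift-local (suc k) zero    f≡g = refl
  shift-local (suc k) (suc m) f≡g = shift-local k m (λ j j≤m → f≡g j (ℕ.m≤n⇒m≤1+n j≤m))

  shift-⊛ : ∀ k f g → shift k f ⊛ g ≐ shift k (f ⊛ g)
  shift-⊛ zero    f g m       = refl
  shift-⊛ (suc k) f g zero    = trans (+-identityˡ _) (*-zeroˡ (g 0))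
  shift-⊛ (suc k) f g (suc m) = begin
      Σ< (suc (suc m)) (λ i → shift (suc k) f i * g (suc m ∸ i))
    ≡⟨ Σ<-suc (suc m) (λ i → shift (suc k) f i * g (suc m ∸ i)) ⟩
      0ℚ * g (suc m) + (shift k f ⊛ g) m
    ≡⟨ trans (cong (_+ (shift k f ⊛ g) m) (*-zeroˡ (g (suc m)))) (+-identityˡ _) ⟩
      (shift k f ⊛ g) m
    ≡⟨ shift-⊛ k f g m ⟩
      shift k (f ⊛ g) m
    ∎
    where open ≡-Reasoning

  qpow-⊛ : ∀ k f → qpow k ⊛ f ≐ shift k f
  qpow-⊛ k f = ≐-trans (shift-⊛ k onePS f) (shift-cong k (⊛-identityˡ f))

  qpow-+ : ∀ a b → qpow (a ℕ.+ b) ≐ qpow a ⊛ qpow b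
  qpow-+ a b = ≐-trans (shift-+ a b onePS) (≐-sym (qpow-⊛ a (qpow b)))

  ·onePS-⊛ : ∀ c f → (c · onePS) ⊛ f ≐ c · f
  ·onePS-⊛ c f m = begin
      Σ< (suc m) (λ i → c * onePS i * f (m ∸ i))
    ≡⟨ Σ<-suc m (λ i → c * onePS i * f (m ∸ i)) ⟩
      c * 1ℚ * f m + Σ< m (λ i → c * 0ℚ * f (m ∸ suc i))
    ≡⟨ cong₂ _+_ (cong (_* f m) (*-identityʳ c))
         (Σ<-≡0 m _ (λ i _ → trans (cong (_* f (m ∸ suc i)) (*-zeroʳ c)) (*-zeroˡ (f (m ∸ suc i))))) ⟩
      c * f m + 0ℚ
    ≡⟨ +-identityʳ (c * f m) ⟩
      c * f m
    ∎
    where open ≡-Reasoning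

module Recurrence where

  open FiniteSums
  open PowerSeries
  open import Data.Bool using (if_then_else_)
  open import Data.Nat as ℕ using (ℕ; zero; suc; _≤_; _<_; s≤s)
  open import Data.Nat.Combinatorics using (_C_)
  open import Data.Nat.Induction using (<-rec)
  open import Data.Product using (_,_)
  open import Data.Rational using (_*_; _-_)
  open import Data.Rational.Properties using (+-0-group)
  open import Algebra.Properties.Group +-0-group using (∙-cancelˡ; ⁻¹-injective)
  open import Relation.Binary.PropositionalEquality

  δ : ℕ → PS
  δ n = if n ℕ.≡ᵇ 0 then onePS else zeroPS

  -- q (q β + 1)^N in umbral notation, β^i standing for b i.
  umbralPower : (ℕ → PS) → ℕ → PS
  umbralPower b N = shift 1 (ΣPS (suc N) (λ i → ⟦ N C i ⟧ · shift i (b i)))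

  umbralPower-local : ∀ b c N m → (∀ i j → i ≤ N → j < m → b i j ≡ c i j) →
    umbralPower b N m ≡ umbralPower c N m
  umbralPower-local b c N zero    b≡c = refl
  umbralPower-local b c N (suc m) b≡c = Σ<-cong (suc N) (λ i i<1+N → cong (⟦ N C i ⟧ *_)
    (shift-local i m (λ j j≤m → b≡c i j (ℕ.≤-pred i<1+N) (s≤s j≤m))))

  IsBernoulliCarlitz-unique : ∀ {b c} → IsBernoulliCarlitz b → IsBernoulliCarlitz c → ∀ N → b N ≐ c N
  IsBernoulliCarlitz-unique {b} {c} (b₀ , b-rec) (c₀ , c-rec) N m =
    <-rec (λ m → ∀ N → b N m ≡ c N m) step m N
    where
    step : ∀ m → (∀ {j} → j < m → ∀ N → b N j ≡ c N j) → ∀ N → b N m ≡ c N m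
    step m IH zero    = trans (b₀ m) (sym (c₀ m))
    step m IH (suc n) = ⁻¹-injective (∙-cancelˡ (umbralPower c (suc n) m) _ _ (begin
        umbralPower c (suc n) m - b (suc n) m  ≡⟨ cong (_- b (suc n) m) (sym same-umbralPower) ⟩
        umbralPower b (suc n) m - b (suc n) m  ≡⟨ b-rec n m ⟩
        δ n m                                  ≡⟨ sym (c-rec n m) ⟩
        umbralPower c (suc n) m - c (suc n) m  ∎))
      where
      open ≡-Reasoning
      same-umbralPower : umbralPower b (suc n) m ≡ umbralPower c (suc n) m
      same-umbralPower = umbralPower-local b c (suc n) m (λ i j _ j<m → IH j<m i)

module SeriesAlgebra where

  open PowerSeries
  open FiniteSums
  open NatCast
  open import Algebra.Bundles using (CommutativeRing)
  open CommutativeRing commutativeRing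
  open import Algebra.Properties.Semiring.Exp semiring using (_^_) public
  open import Algebra.Properties.Semiring.Mult semiring using (_×_) public
  open import Algebra.Properties.Semiring.Mult semiring using (×-congʳ; ×-assoc-*)
  import Algebra.Properties.CommutativeSemiring.Binomial commutativeSemiring as Binomial
  import Algebra.Properties.Monoid.Sum +-monoid as MonoidSum
  import Algebra.Solver.Ring
  import Algebra.Solver.Ring.AlmostCommutativeRing as ACR
  open import Data.Fin using (toℕ)
  open import Data.Maybe using (Maybe; just; nothing)
  open import Relation.Nullary using (yes; no)
  open import Data.Nat as ℕ using (ℕ; zero; suc; _∸_; _<_)
  open import Data.Nat.Combinatorics using (_C_)
  open import Data.Rational as ℚ using (ℚ; 1ℚ)
  import Data.Rational.Properties as ℚ
  open import Function using (_∘_)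
  import Relation.Binary.PropositionalEquality as ≡
  open import Relation.Binary.Reasoning.Setoid setoid

  -- The ring solver takes its coefficients in ℚ, where they compute, and embeds them by κ.
  κ : ℚ → PS
  κ c = c · onePS

  κ-homomorphism : ℚ.+-*-rawRing ACR.-Raw-AlmostCommutative⟶ ACR.fromCommutativeRing commutativeRing
  κ-homomorphism = record
    { ⟦_⟧    = κ
    ; +-homo = λ a b → coeffwise (λ m → ℚ.*-distribʳ-+ (onePS m) a b)
    ; *-homo = λ a b → coeffwise (λ m → ≡.trans (ℚ.*-assoc a b (onePS m)) (≡.sym (·onePS-⊛ a (κ b) m)))
    ; -‿homo = λ a → coeffwise (λ m → ≡.sym (ℚ.neg-distribˡ-* a (onePS m)))
    ; 0-homo = coeffwise (λ m → ℚ.*-zeroˡ (onePS m))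
    ; 1-homo = coeffwise (λ m → ℚ.*-identityˡ (onePS m))
    }

  κ-≟ : ∀ a b → Maybe (κ a ≈ κ b)
  κ-≟ a b with a ℚ.≟ b
  ... | yes ≡.refl = just refl
  ... | no  _      = nothing

  module Solver = Algebra.Solver.Ring ℚ.+-*-rawRing (ACR.fromCommutativeRing commutativeRing)
    κ-homomorphism κ-≟

  open Solver using (solve; _:=_; _:+_; _:*_; _:-_; con)

  ×≈⟦⟧· : ∀ n f → n × f ≈ ⟦ n ⟧ · f
  ×≈⟦⟧· n f = coeffwise (coefficient n)
    where
    coefficient : ∀ n → n × f ≐ ⟦ n ⟧ · f
    coefficient zero    m = ≡.sym (ℚ.*-zeroˡ (f m))
    coefficient (suc n) m = ≡.trans (≡.cong₂ ℚ._+_ (≡.sym (ℚ.*-identityˡ (f m))) (coefficient n m))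
      (≡.trans (≡.sym (ℚ.*-distribʳ-+ (f m) 1ℚ ⟦ n ⟧)) (≡.cong (ℚ._* f m) (≡.sym (⟦⟧-suc n))))

  ΣPS-cong : ∀ n {F G : ℕ → PS} → (∀ i → i < n → F i ≈ G i) → ΣPS n F ≈ ΣPS n G
  ΣPS-cong n F≈G = coeffwise (λ m → Σ<-cong n (λ i i<n → coeff (F≈G i i<n) m))

  ΣPS-suc : ∀ n (F : ℕ → PS) → ΣPS (suc n) F ≈ F 0 + ΣPS n (F ∘ suc)
  ΣPS-suc n F = coeffwise (λ m → Σ<-suc n (λ i → F i m))

  ΣPS-distrib-- : ∀ n (F G : ℕ → PS) → ΣPS n (λ i → F i - G i) ≈ ΣPS n F - ΣPS n G
  ΣPS-distrib-- n F G = coeffwise (λ m → Σ<-distrib-- n (λ i → F i m) (λ i → G i m))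

  *-distribˡ-ΣPS : ∀ n g (F : ℕ → PS) → g * ΣPS n F ≈ ΣPS n (λ i → g * F i)
  *-distribˡ-ΣPS zero    g F = zeroʳ g
  *-distribˡ-ΣPS (suc n) g F =
    trans (distribˡ g (ΣPS n F) (F n)) (+-congʳ {g * F n} (*-distribˡ-ΣPS n g F))

  ΣPS-binomial : ∀ n a → ΣPS (suc n) (λ i → (n C i) × a ^ i) ≈ (a + 1#) ^ n
  ΣPS-binomial n a = sym (begin
      (a + 1#) ^ n
    ≈⟨ Binomial.theorem n a 1# ⟩
      MonoidSum.sum {suc n} (λ i → (n C toℕ i) × (a ^ toℕ i * 1# ^ (n ∸ toℕ i)))
    ≈⟨ sum≈ΣPS (suc n) (λ i → (n C i) × (a ^ i * 1# ^ (n ∸ i))) ⟩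
      ΣPS (suc n) (λ i → (n C i) × (a ^ i * 1# ^ (n ∸ i)))
    ≈⟨ ΣPS-cong (suc n) (λ i _ → ×-congʳ (n C i)
         (trans (*-congˡ {a ^ i} (1#^ (n ∸ i))) (*-identityʳ (a ^ i)))) ⟩
      ΣPS (suc n) (λ i → (n C i) × a ^ i)
    ∎)
    where
    1#^ : ∀ e → 1# ^ e ≈ 1#
    1#^ zero    = refl
    1#^ (suc e) = trans (*-identityˡ (1# ^ e)) (1#^ e)

    sum≈ΣPS : ∀ n (g : ℕ → PS) → MonoidSum.sum (g ∘ toℕ {n}) ≈ ΣPS n g
    sum≈ΣPS zero    g = refl
    sum≈ΣPS (suc n) g = trans (+-congˡ {g 0} (sum≈ΣPS n (g ∘ suc))) (sym (ΣPS-suc n g))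

  ^PS≈^ : ∀ f e → f ^PS e ≈ f ^ e
  ^PS≈^ f zero    = refl
  ^PS≈^ f (suc e) = *-congˡ {f} (^PS≈^ f e)

  q : PS
  q = qpow 1

  -- The ring solver reads the constant 1 as 𝟙, which is equal to 1# only up to _≈_.
  𝟙 : PS
  𝟙 = κ 1ℚ

  𝟙≈1# : 𝟙 ≈ 1#
  𝟙≈1# = coeffwise (λ m → ℚ.*-identityˡ (onePS m))

  qpow-suc : ∀ k → qpow (suc k) ≈ q * qpow k
  qpow-suc k = coeffwise (qpow-+ 1 k)

  qpow≈q^ : ∀ k → qpow k ≈ q ^ k
  qpow≈q^ zero    = refl
  qpow≈q^ (suc k) = trans (qpow-suc k) (*-congˡ {q} (qpow≈q^ k))

  shift≈qpow* : ∀ k f → shift k f ≈ qpow k * f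
  shift≈qpow* k f = coeffwise (≐-sym (qpow-⊛ k f))

  qint-zero : qint 0 ≈ 0#
  qint-zero = coeffwise ≐-refl

  qint-suc : ∀ k → qint (suc k) ≈ q * qint k + 1#
  qint-suc k = coeffwise coefficient
    where
    coefficient : qint (suc k) ≐ q * qint k + 1#
    coefficient zero    =
      ≡.sym (≡.trans (≡.cong (ℚ._+ 1ℚ) (qpow-⊛ 1 (qint k) 0)) (ℚ.+-identityˡ 1ℚ))
    coefficient (suc m) =
      ≡.sym (≡.trans (≡.cong (ℚ._+ ℚ.0ℚ) (qpow-⊛ 1 (qint k) (suc m))) (ℚ.+-identityʳ _))

  geometric-sum : ∀ k → (𝟙 - q) * qint k ≈ 𝟙 - qpow k
  geometric-sum zero = begin
    (𝟙 - q) * qint 0  ≈⟨ trans (*-congˡ {𝟙 - q} qint-zero) (zeroʳ (𝟙 - q)) ⟩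
    0#                ≈⟨ sym (-‿inverseʳ 𝟙) ⟩
    𝟙 - 𝟙             ≈⟨ +-congˡ {𝟙} (-‿cong 𝟙≈1#) ⟩
    𝟙 - qpow 0        ∎
  geometric-sum (suc k) = begin
      (𝟙 - q) * qint (suc k)
    ≈⟨ *-congˡ {𝟙 - q} (trans (qint-suc k) (+-congˡ {q * qint k} (sym 𝟙≈1#))) ⟩
      (𝟙 - q) * (q * qint k + 𝟙)
    ≈⟨ solve 2 (λ q X → (con 1ℚ :- q) :* (q :* X :+ con 1ℚ)
                       := q :* ((con 1ℚ :- q) :* X) :+ (con 1ℚ :- q))
               refl q (qint k) ⟩
      q * ((𝟙 - q) * qint k) + (𝟙 - q)
    ≈⟨ +-congʳ {𝟙 - q} (*-congˡ {q} (geometric-sum k)) ⟩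
      q * (𝟙 - qpow k) + (𝟙 - q)
    ≈⟨ solve 2 (λ q Q → q :* (con 1ℚ :- Q) :+ (con 1ℚ :- q) := con 1ℚ :- q :* Q) refl q (qpow k) ⟩
      𝟙 - q * qpow k
    ≈⟨ +-congˡ {𝟙} (-‿cong (sym (qpow-suc k))) ⟩
      𝟙 - qpow (suc k)
    ∎

  -- Lets the ring solver handle n × _ through the atom n × 1#.
  ×≈×1#* : ∀ n f → n × f ≈ (n × 1#) * f
  ×≈×1#* n f = trans (×-congʳ n (sym (*-identityˡ f))) (sym (×-assoc-* n 1# f))

  ×-distrib-- : ∀ n f g → n × (f - g) ≈ n × f - n × g
  ×-distrib-- n f g = begin
    n × (f - g)                  ≈⟨ ×≈×1#* n (f - g) ⟩
    (n × 1#) * (f - g)           ≈⟨ solve 3 (λ c f g → c :* (f :- g) := c :* f :- c :* g)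
                                            refl (n × 1#) f g ⟩
    (n × 1#) * f - (n × 1#) * g  ≈⟨ sym (+-cong (×≈×1#* n f) (-‿cong (×≈×1#* n g))) ⟩
    n × f - n × g                ∎

module Summands where

  open PowerSeries
  open Recurrence using (δ; umbralPower)
  open SeriesAlgebra
  open BinomialCoefficients
  open import Algebra.Bundles using (CommutativeRing)
  open CommutativeRing commutativeRing
  open import Algebra.Properties.Semiring.Exp semiring using (^-congˡ)
  open import Algebra.Properties.Semiring.Mult semiring using (×-congʳ; ×-comm-*)
  open import Algebra.Properties.Monoid.Mult +-monoid using (×-assocˡ)
  open import Algebra.Properties.CommutativeSemiring.Exp commutativeSemiring using (^-distrib-*)
  open import Data.Nat as ℕ using (ℕ; zero; suc; _∸_)
  open import Data.Nat.Combinatorics using (_C_)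
  import Data.Nat.Properties as ℕ
  open import Data.Rational using (1ℚ)
  import Relation.Binary.PropositionalEquality as ≡
  open import Relation.Binary.Reasoning.Setoid setoid
  open Solver using (solve; _:=_; _:+_; _:*_; _:-_; con)

  β-summand : ℕ → ℕ → PS
  β-summand k i = (𝟙 - q) * (qpow k * qint k ^ i) - i × (qpow k * qpow k * qint k ^ (i ∸ 1))

  umbralPower-β-summand : ∀ k n → umbralPower (β-summand k) (suc n) ≈ β-summand (suc k) (suc n)
  umbralPower-β-summand k n = begin
      umbralPower (β-summand k) N
    ≈⟨ shift≈qpow* 1 _ ⟩
      q * ΣPS (suc N) (λ i → ⟦ N C i ⟧ · shift i (β-summand k i))
    ≈⟨ *-congˡ {q} (ΣPS-cong (suc N) (λ i _ → scaled-summand i)) ⟩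
      q * ΣPS (suc N) (λ i → (N C i) × (c₁ * a ^ i) - (N C i) × (i × (q ^ i * R i)))
    ≈⟨ *-congˡ {q} (trans (ΣPS-distrib-- (suc N) _ _) (+-cong first-sum (-‿cong second-sum))) ⟩
      q * (c₁ * y ^ N - (N × 1#) * (c₂ * y ^ n))
    ≈⟨ solve 6 (λ q o K Y Z c → q :* ((con 1ℚ :- o) :* K :* Y :- c :* (q :* K :* K :* Z))
                               := (con 1ℚ :- o) :* (q :* K :* Y) :- c :* (q :* K :* (q :* K) :* Z))
               refl q q K (y ^ N) (y ^ n) (N × 1#) ⟩
      (𝟙 - q) * (q * K * y ^ N) - (N × 1#) * (q * K * (q * K) * y ^ n)
    ≈⟨ +-congˡ {(𝟙 - q) * (q * K * y ^ N)} (-‿cong (sym (×≈×1#* N (q * K * (q * K) * y ^ n)))) ⟩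
      (𝟙 - q) * (q * K * y ^ N) - N × (q * K * (q * K) * y ^ n)
    ≈⟨ sym (+-cong (*-congˡ {𝟙 - q} (*-cong (qpow-suc k) (^-congˡ N (qint-suc k))))
             (-‿cong (×-congʳ N (*-cong (*-cong (qpow-suc k) (qpow-suc k)) (^-congˡ n (qint-suc k)))))) ⟩
      β-summand (suc k) N
    ∎
    where
    N : ℕ
    N = suc n
    X K a y c₁ c₂ : PS
    X = qint k
    K = qpow k
    a = q * X
    y = a + 1#
    c₁ = (𝟙 - q) * K
    c₂ = q * K * K
    R : ℕ → PS
    R i = K * K * X ^ (i ∸ 1)

    shifted-summand : ∀ i → q ^ i * β-summand k i ≈ c₁ * a ^ i - i × (q ^ i * R i)
    shifted-summand i = begin
        q ^ i * ((𝟙 - q) * (K * X ^ i) - i × R i)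
      ≈⟨ solve 5 (λ u o K v w → u :* ((con 1ℚ :- o) :* (K :* v) :- w)
                               := ((con 1ℚ :- o) :* K) :* (u :* v) :- u :* w)
                 refl (q ^ i) q K (X ^ i) (i × R i) ⟩
        c₁ * (q ^ i * X ^ i) - q ^ i * (i × R i)
      ≈⟨ +-cong (*-congˡ {c₁} (sym (^-distrib-* q X i))) (-‿cong (×-comm-* i (q ^ i) (R i))) ⟩
        c₁ * a ^ i - i × (q ^ i * R i)
      ∎

    scaled-summand : ∀ i → ⟦ N C i ⟧ · shift i (β-summand k i)
                           ≈ (N C i) × (c₁ * a ^ i) - (N C i) × (i × (q ^ i * R i))
    scaled-summand i = begin
        ⟦ N C i ⟧ · shift i (β-summand k i)
      ≈⟨ sym (×≈⟦⟧· (N C i) _) ⟩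
        (N C i) × shift i (β-summand k i)
      ≈⟨ ×-congʳ (N C i) (trans (shift≈qpow* i _) (*-congʳ {β-summand k i} (qpow≈q^ i))) ⟩
        (N C i) × (q ^ i * β-summand k i)
      ≈⟨ ×-congʳ (N C i) (shifted-summand i) ⟩
        (N C i) × (c₁ * a ^ i - i × (q ^ i * R i))
      ≈⟨ ×-distrib-- (N C i) _ _ ⟩
        (N C i) × (c₁ * a ^ i) - (N C i) × (i × (q ^ i * R i))
      ∎

    binomial-term : ℕ → ℕ → PS
    binomial-term m i = (m C i) × a ^ i

    first-sum : ΣPS (suc N) (λ i → (N C i) × (c₁ * a ^ i)) ≈ c₁ * y ^ N
    first-sum = begin
        ΣPS (suc N) (λ i → (N C i) × (c₁ * a ^ i))
      ≈⟨ ΣPS-cong (suc N) (λ i _ → sym (×-comm-* (N C i) c₁ (a ^ i))) ⟩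
        ΣPS (suc N) (λ i → c₁ * binomial-term N i)
      ≈⟨ sym (*-distribˡ-ΣPS (suc N) c₁ (binomial-term N)) ⟩
        c₁ * ΣPS (suc N) (binomial-term N)
      ≈⟨ *-congˡ {c₁} (ΣPS-binomial N a) ⟩
        c₁ * y ^ N
      ∎

    absorbed-term : ∀ j →
      (N C suc j) × (suc j × (q ^ suc j * R (suc j))) ≈ (N × 1#) * (c₂ * binomial-term n j)
    absorbed-term j = begin
        (N C suc j) × (suc j × T)
      ≈⟨ ×-assocˡ T (N C suc j) (suc j) ⟩
        ((N C suc j) ℕ.* suc j) × T
      ≡⟨ ≡.cong (_× T) (≡.trans (ℕ.*-comm (N C suc j) (suc j)) ([k+1]*[n+1]C[k+1]≡[n+1]*nCk n j)) ⟩
        (N ℕ.* (n C j)) × T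
      ≈⟨ trans (sym (×-assocˡ T N (n C j))) (×≈×1#* N ((n C j) × T)) ⟩
        (N × 1#) * ((n C j) × T)
      ≈⟨ *-congˡ {N × 1#} (×-congʳ (n C j) (trans
           (solve 4 (λ q u K v → (q :* u) :* (K :* K :* v) := (q :* K :* K) :* (u :* v))
                    refl q (q ^ j) K (X ^ j))
           (*-congˡ {c₂} (sym (^-distrib-* q X j))))) ⟩
        (N × 1#) * ((n C j) × (c₂ * a ^ j))
      ≈⟨ *-congˡ {N × 1#} (sym (×-comm-* (n C j) c₂ (a ^ j))) ⟩
        (N × 1#) * (c₂ * binomial-term n j)
      ∎
      where
      T : PS
      T = q ^ suc j * R (suc j)

    second-sum : ΣPS (suc N) (λ i → (N C i) × (i × (q ^ i * R i))) ≈ (N × 1#) * (c₂ * y ^ n)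
    second-sum = begin
        ΣPS (suc N) (λ i → (N C i) × (i × (q ^ i * R i)))
      ≈⟨ ΣPS-suc N _ ⟩
        (N C 0) × 0# + ΣPS N tail
      ≈⟨ trans (+-congʳ {ΣPS N tail} (+-identityʳ 0#)) (+-identityˡ (ΣPS N tail)) ⟩
        ΣPS N tail
      ≈⟨ ΣPS-cong N (λ j _ → absorbed-term j) ⟩
        ΣPS N (λ j → (N × 1#) * (c₂ * binomial-term n j))
      ≈⟨ sym (trans (*-congˡ {N × 1#} (*-distribˡ-ΣPS N c₂ (binomial-term n)))
                    (*-distribˡ-ΣPS N (N × 1#) (λ j → c₂ * binomial-term n j))) ⟩
        (N × 1#) * (c₂ * ΣPS N (binomial-term n))
      ≈⟨ *-congˡ {N × 1#} (*-congˡ {c₂} (ΣPS-binomial n a)) ⟩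
        (N × 1#) * (c₂ * y ^ n)
      ∎
      where
      tail : ℕ → PS
      tail j = (N C suc j) × (suc j × (q ^ suc j * R (suc j)))

  β-summand-shift : ∀ k i →
    β-summand k i ≈ shift k ((𝟙 - q) * qint k ^ i - i × (qpow k * qint k ^ (i ∸ 1)))
  β-summand-shift k i = sym (begin
      shift k ((𝟙 - q) * X ^ i - i × (K * X ^ (i ∸ 1)))
    ≈⟨ shift≈qpow* k _ ⟩
      K * ((𝟙 - q) * X ^ i - i × (K * X ^ (i ∸ 1)))
    ≈⟨ solve 4 (λ K o Y w → K :* ((con 1ℚ :- o) :* Y :- w) := (con 1ℚ :- o) :* (K :* Y) :- K :* w)
               refl K q (X ^ i) (i × (K * X ^ (i ∸ 1))) ⟩
      (𝟙 - q) * (K * X ^ i) - K * i × (K * X ^ (i ∸ 1))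
    ≈⟨ +-congˡ {(𝟙 - q) * (K * X ^ i)}
         (-‿cong (trans (×-comm-* i K _) (×-congʳ i (sym (*-assoc K K (X ^ (i ∸ 1))))))) ⟩
      β-summand k i
    ∎)
    where
    X K : PS
    X = qint k
    K = qpow k

  β-summand-at-i=1+e : ∀ k e →
    β-summand k (suc e) ≈ qint k ^ e * qpow k - (2 ℕ.+ e) × (qint k ^ e * (qpow k * qpow k))
  β-summand-at-i=1+e k e = begin
      (𝟙 - q) * (K * (X * Y)) - suc e × (K * K * Y)
    ≈⟨ +-cong (solve 4 (λ o K X Y → (con 1ℚ :- o) :* (K :* (X :* Y)) := ((con 1ℚ :- o) :* X) :* (K :* Y))
                       refl q K X Y)
              (-‿cong (×-congʳ (suc e) (*-comm (K * K) Y))) ⟩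
      ((𝟙 - q) * X) * (K * Y) - suc e × (Y * (K * K))
    ≈⟨ +-congʳ { - (suc e × (Y * (K * K)))} (*-congʳ {K * Y} (geometric-sum k)) ⟩
      (𝟙 - K) * (K * Y) - suc e × (Y * (K * K))
    ≈⟨ solve 3 (λ K Y w → (con 1ℚ :- K) :* (K :* Y) :- w := Y :* K :- (Y :* (K :* K) :+ w))
               refl K Y (suc e × (Y * (K * K))) ⟩
      Y * K - (2 ℕ.+ e) × (Y * (K * K))
    ∎
    where
    X K Y : PS
    X = qint k
    K = qpow k
    Y = X ^ e

  β-summand-at-i=0 : ∀ k → β-summand k 0 ≈ (𝟙 - q) * qpow k
  β-summand-at-i=0 k = begin
    (𝟙 - q) * (qpow k * 1#) - 0#  ≈⟨ +-cong (*-congˡ {𝟙 - q} (*-identityʳ (qpow k))) (coeffwise ≐-refl) ⟩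
    (𝟙 - q) * qpow k + 0#         ≈⟨ +-identityʳ _ ⟩
    (𝟙 - q) * qpow k              ∎

  β-summand-at-k=0 : ∀ n → β-summand 0 (suc n) ≈ ⊝ δ n
  β-summand-at-k=0 n = trans (+-cong first-vanishes refl) (second n)
    where
    [0]^suc : ∀ e → qint 0 ^ suc e ≈ 0#
    [0]^suc e = trans (*-congʳ {qint 0 ^ e} qint-zero) (zeroˡ (qint 0 ^ e))

    first-vanishes : (𝟙 - q) * (1# * qint 0 ^ suc n) ≈ 0#
    first-vanishes = trans (*-congˡ {𝟙 - q} (trans (*-identityˡ _) ([0]^suc n))) (zeroʳ (𝟙 - q))

    second : ∀ n → 0# - suc n × (1# * 1# * qint 0 ^ n) ≈ ⊝ δ n
    second zero    =
      trans (+-identityˡ _) (-‿cong (trans (+-identityʳ _) (trans (*-identityʳ _) (*-identityˡ 1#))))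
    second (suc n) = begin
        0# - suc (suc n) × (1# * 1# * qint 0 ^ suc n)
      ≈⟨ +-congˡ {0#} (-‿cong (×-congʳ (suc (suc n)) vanishes)) ⟩
        0# - suc (suc n) × 0#
      ≈⟨ +-congˡ {0#} (-‿cong (trans (×≈×1#* (suc (suc n)) 0#) (zeroʳ (suc (suc n) × 1#)))) ⟩
        0# - 0#
      ≈⟨ -‿inverseʳ 0# ⟩
        ⊝ δ (suc n)
      ∎
      where
      vanishes : 1# * 1# * qint 0 ^ suc n ≈ 0#
      vanishes = trans (*-congˡ {1# * 1#} ([0]^suc n)) (zeroʳ (1# * 1#))

module BernoulliCarlitzSeries where

  open FiniteSums
  open PowerSeries
  open Recurrence
  open SeriesAlgebra
  open Summands
  open import Algebra.Bundles using (CommutativeRing)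
  open CommutativeRing commutativeRing
  open import Data.Nat as ℕ using (ℕ; zero; suc; _<_)
  open import Data.Nat.Combinatorics using (_C_)
  import Data.Nat.Properties as ℕ
  open import Data.Product using (_,_)
  open import Data.Rational as ℚ using (ℚ; 0ℚ; 1ℚ)
  import Data.Rational.Properties as ℚ
  open import Algebra.Properties.AbelianGroup ℚ.+-0-abelianGroup using (xyx⁻¹≈y)
  open import Data.Sum using (inj₁; inj₂)
  open import Relation.Binary.PropositionalEquality as ≡ using (_≡_)
  open import Relation.Binary.Reasoning.Setoid setoid
  open Solver using (solve; _:=_; _:+_; _:*_; _:-_; :-_; con)

  partialSum : ℕ → ℕ → PS
  partialSum M i = ΣPS M (λ k → β-summand k i)

  β-summand-< : ∀ k i m → m < k → β-summand k i m ≡ 0ℚ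
  β-summand-< k i m m<k = ≡.trans (coeff (β-summand-shift k i) m) (shift-< k _ m m<k)

  -- By β-summand-<, the coefficient of q^m only receives contributions from the summands k ≤ m.
  β-series : ℕ → PS
  β-series i m = partialSum (suc m) i m

  partialSum-stable : ∀ i j M → j < M → partialSum M i j ≡ β-series i j
  partialSum-stable i j (suc M) j<1+M with ℕ.m≤n⇒m<n∨m≡n (ℕ.≤-pred j<1+M)
  ... | inj₂ ≡.refl = ≡.refl
  ... | inj₁ j<M    = ≡.trans (≡.cong₂ ℚ._+_ (partialSum-stable i j M j<M) (β-summand-< M i j j<M))
                              (ℚ.+-identityʳ (β-series i j))

  umbralPower-partialSum : ∀ M N →
    umbralPower (partialSum M) N ≈ ΣPS M (λ k → umbralPower (β-summand k) N)
  umbralPower-partialSum M N = coeffwise (≐-trans (shift-cong 1 swap) (shift-ΣPS 1 M _))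
    where
    swap : ΣPS (suc N) (λ i → ⟦ N C i ⟧ · shift i (partialSum M i))
         ≐ ΣPS M (λ k → ΣPS (suc N) (λ i → ⟦ N C i ⟧ · shift i (β-summand k i)))
    swap m = ≡.trans
      (Σ<-cong-≗ (suc N) (λ i →
        ≡.trans (≡.cong (⟦ N C i ⟧ ℚ.*_) (shift-ΣPS i M (λ k → β-summand k i) m))
                (*-distribˡ-Σ< M ⟦ N C i ⟧ (λ k → shift i (β-summand k i) m))))
      (Σ<-swap (suc N) M (λ i k → ⟦ N C i ⟧ ℚ.* shift i (β-summand k i) m))

  partialSum-recurrence : ∀ M n → umbralPower (partialSum M) (suc n) ≈ partialSum (suc M) (suc n) + δ n
  partialSum-recurrence M n = begin
      umbralPower (partialSum M) (suc n)
    ≈⟨ umbralPower-partialSum M (suc n) ⟩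
      ΣPS M (λ k → umbralPower (β-summand k) (suc n))
    ≈⟨ ΣPS-cong M (λ k _ → umbralPower-β-summand k n) ⟩
      ΣPS M (λ k → β-summand (suc k) (suc n))
    ≈⟨ solve 2 (λ S d → S := (:- d :+ S) :+ d) refl (ΣPS M (λ k → β-summand (suc k) (suc n))) (δ n) ⟩
      (⊝ δ n + ΣPS M (λ k → β-summand (suc k) (suc n))) + δ n
    ≈⟨ +-congʳ {δ n} (sym (trans (ΣPS-suc M (λ k → β-summand k (suc n)))
                                 (+-congʳ (β-summand-at-k=0 n)))) ⟩
      partialSum (suc M) (suc n) + δ n
    ∎

  partialSum-zero : ∀ M → partialSum M 0 ≈ 𝟙 - qpow M
  partialSum-zero zero    = trans (sym (-‿inverseʳ 𝟙)) (+-congˡ {𝟙} (-‿cong 𝟙≈1#))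
  partialSum-zero (suc M) = begin
      partialSum M 0 + β-summand M 0
    ≈⟨ +-cong (partialSum-zero M) (β-summand-at-i=0 M) ⟩
      (𝟙 - qpow M) + (𝟙 - q) * qpow M
    ≈⟨ solve 2 (λ Q q → (con 1ℚ :- Q) :+ (con 1ℚ :- q) :* Q := con 1ℚ :- q :* Q) refl (qpow M) q ⟩
      𝟙 - q * qpow M
    ≈⟨ +-congˡ {𝟙} (-‿cong (sym (qpow-suc M))) ⟩
      𝟙 - qpow (suc M)
    ∎

  β-series-isBernoulliCarlitz : IsBernoulliCarlitz β-series
  β-series-isBernoulliCarlitz = initial , recurrence
    where
    initial : β-series 0 ≐ onePS
    initial m = ≡.trans (coeff (partialSum-zero (suc m)) m)
      (≡.trans (≡.cong (λ c → 𝟙 m ℚ.- c) (shift-< (suc m) onePS m (ℕ.n<1+n m)))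
      (≡.trans (ℚ.+-identityʳ (𝟙 m)) (ℚ.*-identityˡ (onePS m))))

    recurrence : ∀ n → umbralPower β-series (suc n) ⊖ β-series (suc n) ≐ δ n
    recurrence n m = ≡.trans (≡.cong (ℚ._- β-series (suc n) m) truncate)
      (≡.trans (≡.cong (ℚ._- β-series (suc n) m) (coeff (partialSum-recurrence m n) m))
               (xyx⁻¹≈y (β-series (suc n) m) (δ n m)))
      where
      truncate : umbralPower β-series (suc n) m ≡ umbralPower (partialSum m) (suc n) m
      truncate = umbralPower-local β-series (partialSum m) (suc n) m
        (λ i j _ j<m → ≡.sym (partialSum-stable i j m j<m))

module ZetaValues where

  open FiniteSums
  open PowerSeries
  open Recurrence
  open SeriesAlgebra
  open Summands
  open BernoulliCarlitzSeries
  open import Algebra.Bundles using (CommutativeRing)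
  open CommutativeRing commutativeRing
  open import Algebra.Properties.Semiring.Mult semiring using (×-congʳ)
  open import Data.Bool using (Bool; true; false; if_then_else_)
  open import Data.Empty using (⊥-elim)
  open import Data.Nat as ℕ using (ℕ; zero; suc; _<_; _<?_; s≤s)
  import Data.Nat.Properties as ℕ
  open import Data.Rational as ℚ using (ℚ; 0ℚ; 1ℚ)
  import Data.Rational.Properties as ℚ
  open import Relation.Binary.PropositionalEquality as ≡ using (_≡_; _≢_)
  open import Relation.Nullary using (yes; no)
  import Relation.Binary.Reasoning.Setoid setoid as ≈-Reasoning
  open Solver using (solve; _:=_; _:*_; _:-_; con)

  qpow-≡ᵇ : ∀ a i → qpow a i ≡ (if a ℕ.≡ᵇ i then 1ℚ else 0ℚ)
  qpow-≡ᵇ zero    zero    = ≡.refl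
  qpow-≡ᵇ zero    (suc i) = ≡.refl
  qpow-≡ᵇ (suc a) zero    = ≡.refl
  qpow-≡ᵇ (suc a) (suc i) = qpow-≡ᵇ a i

  qpow-≢ : ∀ a i → i ≢ a → qpow a i ≡ 0ℚ
  qpow-≢ zero    zero    i≢a = ⊥-elim (i≢a ≡.refl)
  qpow-≢ zero    (suc i) i≢a = ≡.refl
  qpow-≢ (suc a) zero    i≢a = ≡.refl
  qpow-≢ (suc a) (suc i) i≢a = qpow-≢ a i (λ i≡a → i≢a (≡.cong suc i≡a))

  qpow-diagonal : ∀ a → qpow a a ≡ 1ℚ
  qpow-diagonal zero    = ≡.refl
  qpow-diagonal (suc a) = qpow-diagonal a

  if-then-0ℚ : ∀ (b : Bool) {x} → x ≡ 0ℚ → (if b then x else 0ℚ) ≡ 0ℚ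
  if-then-0ℚ true  x≡0 = x≡0
  if-then-0ℚ false _   = ≡.refl

  dil-qpow : ∀ a k → dil (suc k) (qpow a) ≐ qpow (a ℕ.* suc k)
  dil-qpow a k m with a <? suc m
  ... | yes a<1+m = begin
      dil (suc k) (qpow a) m
    ≡⟨ Σ<-single (suc m) a _ a<1+m (λ i _ i≢a → if-then-0ℚ (i ℕ.* suc k ℕ.≡ᵇ m) (qpow-≢ a i i≢a)) ⟩
      (if a ℕ.* suc k ℕ.≡ᵇ m then qpow a a else 0ℚ)
    ≡⟨ ≡.cong (λ c → if a ℕ.* suc k ℕ.≡ᵇ m then c else 0ℚ) (qpow-diagonal a) ⟩
      (if a ℕ.* suc k ℕ.≡ᵇ m then 1ℚ else 0ℚ)
    ≡⟨ ≡.sym (qpow-≡ᵇ (a ℕ.* suc k) m) ⟩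
      qpow (a ℕ.* suc k) m
    ∎
    where open ≡.≡-Reasoning
  ... | no  a≮1+m = ≡.trans
      (Σ<-≡0 (suc m) _ (λ i i<1+m →
        if-then-0ℚ (i ℕ.* suc k ℕ.≡ᵇ m) (qpow-≢ a i (λ i≡a → a≮1+m (≡.subst (_< suc m) i≡a i<1+m)))))
      (≡.sym (shift-< (a ℕ.* suc k) onePS m (ℕ.<-≤-trans (ℕ.≮⇒≥ a≮1+m) (ℕ.m≤m*n a (suc k)))))

  dil-linear : ∀ k f g c → dil k (f ⊖ (c · g)) ≐ dil k f ⊖ (c · dil k g)
  dil-linear k f g c m = ≡.trans (Σ<-cong-≗ (suc m) (λ i → if-linear (i ℕ.* k ℕ.≡ᵇ m) (f i) (g i)))
    (≡.trans (Σ<-distrib-- (suc m) _ _)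
             (≡.cong (λ z → dil k f m ℚ.- z) (≡.sym (*-distribˡ-Σ< (suc m) c _))))
    where
    if-linear : ∀ b x y →
      (if b then x ℚ.- c ℚ.* y else 0ℚ) ≡ (if b then x else 0ℚ) ℚ.- c ℚ.* (if b then y else 0ℚ)
    if-linear true  x y = ≡.refl
    if-linear false x y = ≡.sym (≡.trans (≡.cong (λ z → 0ℚ ℚ.- z) (ℚ.*-zeroʳ c)) (ℚ.+-inverseʳ 0ℚ))

  *-⊖-· : ∀ x f g c → x * (f ⊖ (c · g)) ≈ (x * f) ⊖ (c · (x * g))
  *-⊖-· x f g c = begin
    x * (f - c · g)          ≈⟨ *-congˡ {x} (+-congˡ {f} (-‿cong (sym (κ* g)))) ⟩
    x * (f - κ c * g)        ≈⟨ solve 4 (λ x f C g → x :* (f :- C :* g) := x :* f :- C :* (x :* g))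
                                        refl x f (κ c) g ⟩
    x * f - κ c * (x * g)    ≈⟨ +-congˡ {x * f} (-‿cong (κ* (x * g))) ⟩
    x * f - c · (x * g)      ∎
    where
    open ≈-Reasoning
    κ* : ∀ h → κ c * h ≈ c · h
    κ* h = coeffwise (·onePS-⊛ c h)

  ζneg-linear : ∀ e f g c → ζneg e (f ⊖ (c · g)) ≐ ζneg e f ⊖ (c · ζneg e g)
  ζneg-linear e f g c m = ≡.trans (Σ<-cong-≗ m (λ j → coeff (summand j) m))
    (≡.trans (Σ<-distrib-- m _ _) (≡.cong (λ z → ζneg e f m ℚ.- z) (≡.sym (*-distribˡ-Σ< m c _))))
    where
    X : ℕ → PS
    X j = qint (suc j) ^PS e

    summand : ∀ j → X j * dil (suc j) (f ⊖ (c · g)) ≈ (X j * dil (suc j) f) ⊖ (c · (X j * dil (suc j) g))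
    summand j = trans (*-congˡ {X j} (coeffwise (dil-linear (suc j) f g c)))
                      (*-⊖-· (X j) (dil (suc j) f) (dil (suc j) g) c)

  ζneg-qpow : ∀ e a → ζneg e (qpow a) ≐ lamSum e a
  ζneg-qpow e a m = Σ<-cong-≗ m (λ j → ⊛-cong {qint (suc j) ^PS e} ≐-refl (dil-qpow a j) m)

  qpow-1* : ∀ k → qpow (1 ℕ.* k) ≈ qpow k
  qpow-1* k = coeffwise (λ m → ≡.cong (λ a → qpow a m) (ℕ.*-identityˡ k))

  qpow-2* : ∀ k → qpow (2 ℕ.* k) ≈ qpow k * qpow k
  qpow-2* k = coeffwise (≐-trans (λ m → ≡.cong (λ a → qpow (k ℕ.+ a) m) (ℕ.+-identityʳ k)) (qpow-+ k k))

  β-summand-lamSum-term : ∀ k e →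
    β-summand k (suc e)
      ≈ (qint k ^PS e * qpow (1 ℕ.* k)) ⊖ (⟦ suc e ℕ.+ 1 ⟧ · (qint k ^PS e * qpow (2 ℕ.* k)))
  β-summand-lamSum-term k e = begin
      β-summand k (suc e)
    ≈⟨ β-summand-at-i=1+e k e ⟩
      qint k ^ e * qpow k - (2 ℕ.+ e) × (qint k ^ e * (qpow k * qpow k))
    ≈⟨ +-cong (*-cong (sym (^PS≈^ (qint k) e)) (sym (qpow-1* k)))
              (-‿cong (×-congʳ (2 ℕ.+ e) (*-cong (sym (^PS≈^ (qint k) e)) (sym (qpow-2* k))))) ⟩
      qint k ^PS e * qpow (1 ℕ.* k) - (2 ℕ.+ e) × (qint k ^PS e * qpow (2 ℕ.* k))
    ≈⟨ +-congˡ {qint k ^PS e * qpow (1 ℕ.* k)} (-‿cong (×≈⟦⟧· (2 ℕ.+ e) _)) ⟩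
      qint k ^PS e * qpow (1 ℕ.* k) - ⟦ 2 ℕ.+ e ⟧ · (qint k ^PS e * qpow (2 ℕ.* k))
    ≡⟨ ≡.cong (λ c → qint k ^PS e * qpow (1 ℕ.* k) - ⟦ c ⟧ · (qint k ^PS e * qpow (2 ℕ.* k)))
              (ℕ.+-comm 1 (suc e)) ⟩
      (qint k ^PS e * qpow (1 ℕ.* k)) ⊖ (⟦ suc e ℕ.+ 1 ⟧ · (qint k ^PS e * qpow (2 ℕ.* k)))
    ∎
    where open ≈-Reasoning

  β-series-lamSum : ∀ e →
    β-series (suc (suc e)) ≐ lamSum (suc e) 1 ⊖ (⟦ suc (suc e) ℕ.+ 1 ⟧ · lamSum (suc e) 2)
  β-series-lamSum e m = begin
      β-series N m
    ≡⟨ Σ<-suc m (λ k → β-summand k N m) ⟩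
      β-summand 0 N m ℚ.+ Σ< m (λ j → β-summand (suc j) N m)
    ≡⟨ ≡.cong₂ ℚ._+_ (coeff (β-summand-at-k=0 (suc e)) m)
         (Σ<-cong-≗ m (λ j → coeff (β-summand-lamSum-term (suc j) (suc e)) m)) ⟩
      0ℚ ℚ.+ Σ< m (λ j → A j m ℚ.- c ℚ.* B j m)
    ≡⟨ ℚ.+-identityˡ _ ⟩
      Σ< m (λ j → A j m ℚ.- c ℚ.* B j m)
    ≡⟨ Σ<-distrib-- m (λ j → A j m) (λ j → c ℚ.* B j m) ⟩
      lamSum (suc e) 1 m ℚ.- Σ< m (λ j → c ℚ.* B j m)
    ≡⟨ ≡.cong (λ z → lamSum (suc e) 1 m ℚ.- z) (≡.sym (*-distribˡ-Σ< m c (λ j → B j m))) ⟩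
      lamSum (suc e) 1 m ℚ.- c ℚ.* lamSum (suc e) 2 m
    ∎
    where
    N : ℕ
    N = suc (suc e)
    c : ℚ
    c = ⟦ N ℕ.+ 1 ⟧
    A B : ℕ → PS
    A j = qint (suc j) ^PS suc e * qpow (1 ℕ.* suc j)
    B j = qint (suc j) ^PS suc e * qpow (2 ℕ.* suc j)
    open ≡.≡-Reasoning

  ζneg-qpow-⊖ : ∀ e a b c → ζneg e (qpow a ⊖ (c · qpow b)) ≐ lamSum e a ⊖ (c · lamSum e b)
  ζneg-qpow-⊖ e a b c m = ≡.trans (ζneg-linear e (qpow a) (qpow b) c m)
    (≡.cong₂ (λ x y → x ℚ.- c ℚ.* y) (ζneg-qpow e a m) (ζneg-qpow e b m))

open import Data.Nat using (ℕ; suc; _∸_; _+_)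
open import Data.Product using (_×_; _,_)
open import Data.Rational using (ℚ)
open PowerSeries using (≐-trans; ≐-sym)
open Recurrence using (IsBernoulliCarlitz-unique)
open BernoulliCarlitzSeries using (β-series; β-series-isBernoulliCarlitz)
open ZetaValues using (β-series-lamSum; ζneg-qpow-⊖)

mainTheorem3 : (b : ℕ → PS) → IsBernoulliCarlitz b → (n : ℕ) →
    let N = suc (suc n) in
    (b N ≐ ζneg (N ∸ 1) (qpow 1 ⊖ (⟦ N + 1 ⟧ · qpow 2)))
    × (b N ≐ lamSum (N ∸ 1) 1 ⊖ (⟦ N + 1 ⟧ · lamSum (N ∸ 1) 2))
mainTheorem3 b isBernoulliCarlitz n = ≐-trans b≐lamSum (≐-sym ζneg≐lamSum) , b≐lamSum
  where
  c : ℚ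
  c = ⟦ suc (suc n) + 1 ⟧

  b≐β-series : b (suc (suc n)) ≐ β-series (suc (suc n))
  b≐β-series = IsBernoulliCarlitz-unique isBernoulliCarlitz β-series-isBernoulliCarlitz (suc (suc n))

  b≐lamSum : b (suc (suc n)) ≐ lamSum (suc n) 1 ⊖ (c · lamSum (suc n) 2)
  b≐lamSum = ≐-trans b≐β-series (β-series-lamSum n)

  ζneg≐lamSum : ζneg (suc n) (qpow 1 ⊖ (c · qpow 2)) ≐ lamSum (suc n) 1 ⊖ (c · lamSum (suc n) 2)
  ζneg≐lamSum = ζneg-qpow-⊖ (suc n) 1 2 c
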